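{- Let $(\mathbb{L},\Box,\Diamond)$ be an $\mathcal{L}$-algebra. (3) If $i:\mathbb{L}\to\mathbf{A}$ is an $\mathbf{A}$-ideal, then so is $i^{ -\Box}$. (4) If $\mathbb{L}=\mathbf{Fm}$ is the Lindenbaum–Tarski algebra of $\mathcal{L}$-formulas and $i:\mathbf{Fm}\to\mathbf{A}$ is a proper $\mathbf{A}$-ideal, then $i^{ -\Box}$ is a proper $\mathbf{A}$-ideal.
   Context: $\mathbf{A}=(D,1,0,\vee,\wedge,\otimes,\to)$ is a complete, commutative, associative residuated lattice which is frame-distributive and dually frame-distributive (finite meets distribute over arbitrary joins and dually), with $1\to\alpha=\alpha$ for all $\alpha$. An $\mathcal{L}$-algebra is a bounded lattice $\mathbb{L}$ with unary operations $\Box$ preserving finite meets (including $\Box\top=\top$) and $\Diamond$ preserving finite joins (including $\Diamond\bot=\bot$), both monotone. An $\mathbf{A}$-ideal of $\mathbb{L}$ is a map $i:\mathbb{L}\to\mathbf{A}$ with $i(\bot)=1$ and $i(a\vee b)=i(a)\wedge i(b)$; it is proper if moreover $i(\top)=0$. For $k:\mathbb{L}\to\mathbf{A}$, $k^{ -\Box}(a):=\bigvee\{k(b)\mid a\le\Box b\}$. The language $\mathcal{L}$ is $\varphi::=\bot\mid\top\mid p\mid\varphi\wedge\varphi\mid\varphi\vee\varphi\mid\Box\varphi\mid\Diamond\varphi$, and $\mathbf{Fm}$ is the Lindenbaum–Tarski algebra of $\mathcal{L}$-formulas modulo interderivability in the basic normal non-distributive modal logic $\mathbf{L}$ (the least set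 of sequents containing the lattice axioms $p\vdash p$, $\bot\vdash p$, $p\vdash\top$, $p\vdash p\vee q$, $q\vdash p\vee q$, $p\wedge q\vdash p$, $p\wedge q\vdash q$, and $\top\vdash\Box\top$, $\Box p\wedge\Box q\vdash\Box(p\wedge q)$, $\Diamond\bot\vdash\bot$, $\Diamond(p\vee q)\vdash\Diamond p\vee\Diamond q$, closed under cut, substitution, the $\wedge$-introduction on the right and $\vee$-introduction on the left rules, and monotonicity of $\Box$ and $\Diamond$); its order is $[\phi]\le[\psi]$ iff $\phi\vdash\psi\in\mathbf{L}$. -}

module Defs where

open import Data.Product using (Σ; _×_; _,_)
open import Relation.Binary.PropositionalEquality using (_≡_)

record ResLattice : Set₁ where
  infix  4 _≤_
  infixr 6 _∨_
  infixr 7 _∧_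
  field
    D      : Set
    _≤_    : D → D → Set
    ≤-refl  : ∀ {α} → α ≤ α
    ≤-trans : ∀ {α β γ} → α ≤ β → β ≤ γ → α ≤ γ
    ≤-antisym : ∀ {α β} → α ≤ β → β ≤ α → α ≡ β
    𝟙 𝟘    : D
    ≤-𝟙    : ∀ {α} → α ≤ 𝟙
    𝟘-≤    : ∀ {α} → 𝟘 ≤ α
    _∧_ _∨_ : D → D → D
    ∧-lb₁  : ∀ {α β} → α ∧ β ≤ α
    ∧-lb₂  : ∀ {α β} → α ∧ β ≤ β
    ∧-glb  : ∀ {α β γ} → γ ≤ α → γ ≤ β → γ ≤ α ∧ β
    ∨-ub₁  : ∀ {α β} → α ≤ α ∨ β
    ∨-ub₂  : ∀ {α β} → β ≤ α ∨ β
    ∨-lub  : ∀ {α β γ} → α ≤ γ → β ≤ γ → α ∨ β ≤ γ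
    ⋁      : {I : Set} → (I → D) → D
    ⋁-ub   : ∀ {I} (f : I → D) (i : I) → f i ≤ ⋁ f
    ⋁-lub  : ∀ {I} (f : I → D) {γ} → (∀ i → f i ≤ γ) → ⋁ f ≤ γ
    ⋀      : {I : Set} → (I → D) → D
    ⋀-lb   : ∀ {I} (f : I → D) (i : I) → ⋀ f ≤ f i
    ⋀-glb  : ∀ {I} (f : I → D) {γ} → (∀ i → γ ≤ f i) → γ ≤ ⋀ f
    frame-distrib  : ∀ {I} (α : D) (f : I → D) → α ∧ ⋁ f ≡ ⋁ (λ i → α ∧ f i)
    dframe-distrib : ∀ {I} (α : D) (f : I → D) → α ∨ ⋀ f ≡ ⋀ (λ i → α ∨ f i)
    _⊗_    : D → D → D
    _⇒_    : D → D → D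
    ⊗-comm  : ∀ α β → α ⊗ β ≡ β ⊗ α
    ⊗-assoc : ∀ α β γ → (α ⊗ β) ⊗ γ ≡ α ⊗ (β ⊗ γ)
    residuation₁ : ∀ {α β γ} → α ⊗ β ≤ γ → β ≤ α ⇒ γ
    residuation₂ : ∀ {α β γ} → β ≤ α ⇒ γ → α ⊗ β ≤ γ
    𝟙⇒     : ∀ α → 𝟙 ⇒ α ≡ α

-- L-algebras: bounded lattices (presented order-theoretically on a
-- preorder; equality is mutual ≤) with □ preserving finite meets and
-- ◇ preserving finite joins, both monotone.

record LAlgebra : Set₁ where
  infix  4 _≤_
  infixr 6 _∨_
  infixr 7 _∧_
  field
    Carrier : Set
    _≤_     : Carrier → Carrier → Set
    ≤-refl  : ∀ {a} → a ≤ a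
    ≤-trans : ∀ {a b c} → a ≤ b → b ≤ c → a ≤ c
    ⊤ ⊥     : Carrier
    ≤-⊤     : ∀ {a} → a ≤ ⊤
    ⊥-≤     : ∀ {a} → ⊥ ≤ a
    _∧_ _∨_ : Carrier → Carrier → Carrier
    ∧-lb₁   : ∀ {a b} → a ∧ b ≤ a
    ∧-lb₂   : ∀ {a b} → a ∧ b ≤ b
    ∧-glb   : ∀ {a b c} → c ≤ a → c ≤ b → c ≤ a ∧ b
    ∨-ub₁   : ∀ {a b} → a ≤ a ∨ b
    ∨-ub₂   : ∀ {a b} → b ≤ a ∨ b
    ∨-lub   : ∀ {a b c} → a ≤ c → b ≤ c → a ∨ b ≤ c
    □ ◇     : Carrier → Carrier
    □-mono  : ∀ {a b} → a ≤ b → □ a ≤ □ b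
    ◇-mono  : ∀ {a b} → a ≤ b → ◇ a ≤ ◇ b
    □-⊤     : (□ ⊤ ≤ ⊤) × (⊤ ≤ □ ⊤)
    □-∧     : ∀ a b → (□ (a ∧ b) ≤ □ a ∧ □ b) × (□ a ∧ □ b ≤ □ (a ∧ b))
    ◇-⊥     : (◇ ⊥ ≤ ⊥) × (⊥ ≤ ◇ ⊥)
    ◇-∨     : ∀ a b → (◇ (a ∨ b) ≤ ◇ a ∨ ◇ b) × (◇ a ∨ ◇ b ≤ ◇ (a ∨ b))

  _≈_ : Carrier → Carrier → Set
  a ≈ b = (a ≤ b) × (b ≤ a)

-- A-ideals.  A map L → A is a function on carriers respecting the
-- equality ≈ of L (i.e. a map on the underlying set of the lattice).

module _ (A : ResLattice) (L : LAlgebra) where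
  private
    module A = ResLattice A
    module L = LAlgebra L

  record IsIdeal (i : L.Carrier → A.D) : Set where
    field
      respects : ∀ {a b} → a L.≈ b → i a ≡ i b
      ideal-⊥  : i L.⊥ ≡ A.𝟙
      ideal-∨  : ∀ a b → i (a L.∨ b) ≡ i a A.∧ i b

  record IsProperIdeal (i : L.Carrier → A.D) : Set where
    field
      isIdeal  : IsIdeal i
      proper-⊤ : i L.⊤ ≡ A.𝟘

  boxInv : (L.Carrier → A.D) → L.Carrier → A.D
  boxInv k a = A.⋁ {Σ L.Carrier (λ b → a L.≤ L.□ b)} (λ { (b , _) → k b })

infixr 6 _∨ᶠ_
infixr 7 _∧ᶠ_
infix  3 _⊢_

data Form (Prop : Set) : Set where
  var      : Prop → Form Prop
  ⊥ᶠ ⊤ᶠ    : Form Prop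
  _∧ᶠ_ _∨ᶠ_ : Form Prop → Form Prop → Form Prop
  □ᶠ ◇ᶠ    : Form Prop → Form Prop

-- The basic normal non-distributive modal logic L.  Axioms are given as
-- schemata (this builds in closure under uniform substitution).
data _⊢_ {Prop : Set} : Form Prop → Form Prop → Set where
  ax-id    : ∀ {p} → p ⊢ p
  ax-⊥     : ∀ {p} → ⊥ᶠ ⊢ p
  ax-⊤     : ∀ {p} → p ⊢ ⊤ᶠ
  ax-∨₁    : ∀ {p q} → p ⊢ p ∨ᶠ q
  ax-∨₂    : ∀ {p q} → q ⊢ p ∨ᶠ q
  ax-∧₁    : ∀ {p q} → p ∧ᶠ q ⊢ p
  ax-∧₂    : ∀ {p q} → p ∧ᶠ q ⊢ q
  ax-□⊤    : ⊤ᶠ ⊢ □ᶠ ⊤ᶠ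
  ax-□∧    : ∀ {p q} → □ᶠ p ∧ᶠ □ᶠ q ⊢ □ᶠ (p ∧ᶠ q)
  ax-◇⊥    : ◇ᶠ ⊥ᶠ ⊢ ⊥ᶠ
  ax-◇∨    : ∀ {p q} → ◇ᶠ (p ∨ᶠ q) ⊢ ◇ᶠ p ∨ᶠ ◇ᶠ q
  cut      : ∀ {φ ψ χ} → φ ⊢ ψ → ψ ⊢ χ → φ ⊢ χ
  ∧R       : ∀ {φ ψ χ} → φ ⊢ ψ → φ ⊢ χ → φ ⊢ ψ ∧ᶠ χ
  ∨L       : ∀ {φ ψ χ} → φ ⊢ χ → ψ ⊢ χ → φ ∨ᶠ ψ ⊢ χ
  □-mono   : ∀ {φ ψ} → φ ⊢ ψ → □ᶠ φ ⊢ □ᶠ ψ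
  ◇-mono   : ∀ {φ ψ} → φ ⊢ ψ → ◇ᶠ φ ⊢ ◇ᶠ ψ

-- The Lindenbaum–Tarski algebra Fm (formulas modulo interderivability,
-- presented as a setoid: equality is mutual derivability).
Fm : (Prop : Set) → LAlgebra
Fm Prop = record
  { Carrier = Form Prop
  ; _≤_     = _⊢_
  ; ≤-refl  = ax-id
  ; ≤-trans = cut
  ; ⊤ = ⊤ᶠ ; ⊥ = ⊥ᶠ
  ; ≤-⊤ = ax-⊤ ; ⊥-≤ = ax-⊥
  ; _∧_ = _∧ᶠ_ ; _∨_ = _∨ᶠ_
  ; ∧-lb₁ = ax-∧₁ ; ∧-lb₂ = ax-∧₂ ; ∧-glb = ∧R
  ; ∨-ub₁ = ax-∨₁ ; ∨-ub₂ = ax-∨₂ ; ∨-lub = ∨L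
  ; □ = □ᶠ ; ◇ = ◇ᶠ
  ; □-mono = □-mono ; ◇-mono = ◇-mono
  ; □-⊤ = ax-⊤ , ax-□⊤
  ; □-∧ = λ a b → ∧R (□-mono ax-∧₁) (□-mono ax-∧₂) , ax-□∧
  ; ◇-⊥ = ax-◇⊥ , ax-⊥
  ; ◇-∨ = λ a b → ax-◇∨ , ∨L (◇-mono ax-∨₁) (◇-mono ax-∨₂)
  }

module Submission where

-- For any map k,
-- k⁻□ is antitone, which gives invariance under ≈ and the inequality
-- k⁻□(a ∨ b) ≤ k⁻□(a) ∧ k⁻□(b).  For an ideal i the converse
-- inequality follows from frame distributivity: the meet of the two
-- joins is the join of the i(c) ∧ i(d) = i(c ∨ d) with a ≤ □c, b ≤ □d,
-- and then a ∨ b ≤ □(c ∨ d).  Finally i⁻□(⊥) ≥ i(⊥) = 1 since ⊥ ≤ □⊥.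
--
-- For properness we show, for any L-algebra in which ⊤ ≤ □b implies
-- ⊤ ≤ b, that every b indexing i⁻□(⊤) has i(b) = i(⊤) = 0.  The
-- Lindenbaum–Tarski algebra has this property: interpreting formulas
-- two-valuedly with variables and ◇ false and □ the identity is sound
-- for L, and every formula true in this interpretation is derivable
-- from ⊤; so ⊤ ⊢ □b gives ⊤ ⊢ b.

open import Defs
open import Data.Product using (_×_; _,_)
open import Data.Sum using (_⊎_; inj₁; inj₂)
open import Data.Empty using () renaming (⊥ to False)
open import Data.Unit using (tt) renaming (⊤ to True)
open import Relation.Binary.PropositionalEquality using (_≡_; sym; trans; subst)

module FrameFacts (A : ResLattice) where
  open ResLattice A

  ∧-⋁-lub : ∀ {J} α (g : J → D) {γ} → (∀ j → α ∧ g j ≤ γ) → α ∧ ⋁ g ≤ γ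
  ∧-⋁-lub α g bound = subst (_≤ _) (sym (frame-distrib α g)) (⋁-lub _ bound)

  ∧-swap : ∀ {α β} → α ∧ β ≤ β ∧ α
  ∧-swap = ∧-glb ∧-lb₂ ∧-lb₁

  ⋁-∧-⋁-lub : ∀ {I J} (f : I → D) (g : J → D) {γ} →
              (∀ i j → f i ∧ g j ≤ γ) → ⋁ f ∧ ⋁ g ≤ γ
  ⋁-∧-⋁-lub f g bound =
    ≤-trans ∧-swap (∧-⋁-lub (⋁ g) f λ i →
      ≤-trans ∧-swap (∧-⋁-lub (f i) g (bound i)))

□-Reflects-⊤ : LAlgebra → Set
□-Reflects-⊤ L = ∀ b → ⊤ ≤ □ b → ⊤ ≤ b
  where open LAlgebra L

module BoxInverse (A : ResLattice) (L : LAlgebra) where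
  private
    module A = ResLattice A
    module L = LAlgebra L
  open FrameFacts A

  boxInv-ub : (k : L.Carrier → A.D) {a b : L.Carrier} →
              a L.≤ L.□ b → k b A.≤ boxInv A L k a
  boxInv-ub k {b = b} a≤□b = A.⋁-ub _ (b , a≤□b)

  boxInv-antitone : (k : L.Carrier → A.D) {a a′ : L.Carrier} →
                    a L.≤ a′ → boxInv A L k a′ A.≤ boxInv A L k a
  boxInv-antitone k a≤a′ =
    A.⋁-lub _ λ { (b , a′≤□b) → boxInv-ub k (L.≤-trans a≤a′ a′≤□b) }

  module _ {i : L.Carrier → A.D} (ideal : IsIdeal A L i) where
    open IsIdeal ideal

    boxInv-respects : ∀ {a b} → a L.≈ b → boxInv A L i a ≡ boxInv A L i b
    boxInv-respects (a≤b , b≤a) =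
      A.≤-antisym (boxInv-antitone i b≤a) (boxInv-antitone i a≤b)

    -- ⊥ ≤ □⊥, so i⁻□(⊥) ≥ i(⊥) = 1.
    boxInv-⊥ : boxInv A L i L.⊥ ≡ A.𝟙
    boxInv-⊥ = A.≤-antisym A.≤-𝟙
      (subst (A._≤ boxInv A L i L.⊥) ideal-⊥ (boxInv-ub i L.⊥-≤))

    -- Witnesses c for a and d for b combine into the witness c ∨ d
    -- for a ∨ b, and i(c) ∧ i(d) = i(c ∨ d).
    boxInv-∧-≤-∨ : ∀ a b → boxInv A L i a A.∧ boxInv A L i b A.≤ boxInv A L i (a L.∨ b)
    boxInv-∧-≤-∨ a b = ⋁-∧-⋁-lub _ _ λ { (c , a≤□c) (d , b≤□d) →
      subst (A._≤ boxInv A L i (a L.∨ b)) (ideal-∨ c d)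
        (boxInv-ub i (L.∨-lub (L.≤-trans a≤□c (L.□-mono L.∨-ub₁))
                              (L.≤-trans b≤□d (L.□-mono L.∨-ub₂)))) }

    boxInv-∨ : ∀ a b → boxInv A L i (a L.∨ b) ≡ boxInv A L i a A.∧ boxInv A L i b
    boxInv-∨ a b = A.≤-antisym
      (A.∧-glb (boxInv-antitone i L.∨-ub₁) (boxInv-antitone i L.∨-ub₂))
      (boxInv-∧-≤-∨ a b)

    boxInv-ideal : IsIdeal A L (boxInv A L i)
    boxInv-ideal = record
      { respects = boxInv-respects ; ideal-⊥ = boxInv-⊥ ; ideal-∨ = boxInv-∨ }

  -- If □ reflects ⊤, every b indexing i⁻□(⊤) is equivalent to ⊤,
  -- hence has i(b) = i(⊤) = 0.
  boxInv-proper : □-Reflects-⊤ L → {i : L.Carrier → A.D} →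
                  IsProperIdeal A L i → IsProperIdeal A L (boxInv A L i)
  boxInv-proper reflects {i} proper = record
    { isIdeal  = boxInv-ideal isIdeal
    ; proper-⊤ = A.≤-antisym
        (A.⋁-lub _ λ { (b , ⊤≤□b) →
          subst (A._≤ A.𝟘)
            (sym (trans (respects (L.≤-⊤ , reflects b ⊤≤□b)) proper-⊤)) A.≤-refl })
        A.𝟘-≤
    }
    where
    open IsProperIdeal proper
    open IsIdeal isIdeal

module LindenbaumTarski {Prop : Set} where

  Holds : Form Prop → Set
  Holds (var _)  = False
  Holds ⊥ᶠ       = False
  Holds ⊤ᶠ       = True
  Holds (φ ∧ᶠ ψ) = Holds φ × Holds ψ
  Holds (φ ∨ᶠ ψ) = Holds φ ⊎ Holds ψ
  Holds (□ᶠ φ)   = Holds φ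
  Holds (◇ᶠ φ)   = False

  sound : ∀ {φ ψ : Form Prop} → φ ⊢ ψ → Holds φ → Holds ψ
  sound ax-id       h         = h
  sound ax-⊤        _         = tt
  sound ax-∨₁       h         = inj₁ h
  sound ax-∨₂       h         = inj₂ h
  sound ax-∧₁       (h , _)   = h
  sound ax-∧₂       (_ , h)   = h
  sound ax-□⊤       h         = h
  sound ax-□∧       h         = h
  sound (cut d e)   h         = sound e (sound d h)
  sound (∧R d e)    h         = sound d h , sound e h
  sound (∨L d e)    (inj₁ h)  = sound d h
  sound (∨L d e)    (inj₂ h)  = sound e h
  sound (□-mono d)  h         = sound d h

  from-⊤ : ∀ φ → Holds φ → ⊤ᶠ ⊢ φ
  from-⊤ ⊤ᶠ       _        = ax-id
  from-⊤ (φ ∧ᶠ ψ) (h , h′) = ∧R (from-⊤ φ h) (from-⊤ ψ h′)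
  from-⊤ (φ ∨ᶠ ψ) (inj₁ h) = cut (from-⊤ φ h) ax-∨₁
  from-⊤ (φ ∨ᶠ ψ) (inj₂ h) = cut (from-⊤ ψ h) ax-∨₂
  from-⊤ (□ᶠ φ)   h        = cut ax-□⊤ (□-mono (from-⊤ φ h))

  □-reflects-⊤ : □-Reflects-⊤ (Fm Prop)
  □-reflects-⊤ b ⊤⊢□b = from-⊤ b (sound ⊤⊢□b tt)

lemmaA1 : (A : ResLattice) →
    ((L : LAlgebra) (i : LAlgebra.Carrier L → ResLattice.D A) →
      IsIdeal A L i → IsIdeal A L (boxInv A L i))
    ×
    ((Prop : Set) (i : Form Prop → ResLattice.D A) →
      IsProperIdeal A (Fm Prop) i → IsProperIdeal A (Fm Prop) (boxInv A (Fm Prop) i))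
lemmaA1 A =
  (λ L i → BoxInverse.boxInv-ideal A L)
  , (λ Prop i → BoxInverse.boxInv-proper A (Fm Prop)
                  LindenbaumTarski.□-reflects-⊤)
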